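{- Let $G=(K,S,E(G))$ be a split graph on $n$ vertices, and let $T'$ be the set of triangles of $G$ that have at least one vertex in $K$ and at least one vertex in $S$. Then $\nu(G)\ge \frac{|T'|}{\max\{|S|,|K|\}}$.
   Context: A split graph $G=(K,S,E(G))$ is a graph whose vertex set is partitioned into a clique $K$ and an independent set $S$. $\nu(G)$ is the maximum number of pairwise edge-disjoint triangles in $G$. -}

module Defs where

open import Data.Nat using (ℕ; _<ᵇ_; _⊔_; _≤_)
open import Data.Fin using (Fin; toℕ)
open import Data.Bool using (Bool; true; false; _∧_; _∨_; not)
open import Data.List using (List; length; filterᵇ; concatMap; map; allFin)
open import Data.List.Relation.Unary.AllPairs using (AllPairs)
open import Data.Product using (Σ; _×_; _,_)
open import Data.Sum using (_⊎_)
open import Data.Empty using (⊥)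
open import Relation.Binary.PropositionalEquality using (_≡_; _≢_)

record Graph (n : ℕ) : Set where
  field
    adj   : Fin n → Fin n → Bool
    sym   : ∀ u v → adj u v ≡ adj v u
    irrefl : ∀ u → adj u u ≡ false
open Graph public

record SplitGraph (n : ℕ) : Set where
  field
    graph : Graph n
    inK   : Fin n → Bool
    K-clique : ∀ u v → u ≢ v → inK u ≡ true → inK v ≡ true → adj graph u v ≡ true
    S-indep  : ∀ u v → inK u ≡ false → inK v ≡ false → adj graph u v ≡ false
open SplitGraph public

sizeK : ∀ {n} → SplitGraph n → ℕ
sizeK {n} G = length (filterᵇ (inK G) (allFin n))

sizeS : ∀ {n} → SplitGraph n → ℕ
sizeS {n} G = length (filterᵇ (λ v → not (inK G v)) (allFin n))

record Triangle {n : ℕ} (G : Graph n) : Set where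
  constructor tri
  field
    a b c : Fin n
    a<b : (toℕ a <ᵇ toℕ b) ≡ true
    b<c : (toℕ b <ᵇ toℕ c) ≡ true
    ab : adj G a b ≡ true
    ac : adj G a c ≡ true
    bc : adj G b c ≡ true
open Triangle public

_∈▵_ : ∀ {n} {G : Graph n} → Fin n → Triangle G → Set
u ∈▵ t = u ≡ a t ⊎ u ≡ b t ⊎ u ≡ c t

EdgeDisjoint : ∀ {n} {G : Graph n} → Triangle G → Triangle G → Set
EdgeDisjoint {n} t t' = ∀ (u v : Fin n) → u ≢ v → u ∈▵ t → v ∈▵ t → u ∈▵ t' → v ∈▵ t' → ⊥

IsNu : ∀ {n} → Graph n → ℕ → Set
IsNu G m = (Σ (List (Triangle G)) λ ts → AllPairs EdgeDisjoint ts × length ts ≡ m)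
         × (∀ (ts : List (Triangle G)) → AllPairs EdgeDisjoint ts → length ts ≤ m)

triples : (n : ℕ) → List (Fin n × Fin n × Fin n)
triples n = concatMap (λ x → concatMap (λ y → map (λ z → (x , y , z)) (allFin n)) (allFin n)) (allFin n)

isT' : ∀ {n} → SplitGraph n → Fin n × Fin n × Fin n → Bool
isT' G (x , y , z) =
  (toℕ x <ᵇ toℕ y) ∧ (toℕ y <ᵇ toℕ z)
  ∧ adj (graph G) x y ∧ adj (graph G) x z ∧ adj (graph G) y z
  ∧ (inK G x ∨ inK G y ∨ inK G z)
  ∧ (not (inK G x) ∨ not (inK G y) ∨ not (inK G z))

sizeT' : ∀ {n} → SplitGraph n → ℕ
sizeT' {n} G = length (filterᵇ (isT' G) (triples n))

module Submission where

-- Number the vertices of K, and separately those of S, as 0, 1, 2, … in increasing order;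
-- all labels are below m = max(|S|, |K|). Colour a triangle of T' by the sum of its three
-- labels modulo m. Since S is independent, every triangle of T' has two vertices in K and
-- one in S. So if two triangles of the same colour share an edge uv, their third vertices
-- lie on the same side and have the same label modulo m, hence coincide. Each of the m
-- colour classes is therefore a family of pairwise edge-disjoint triangles, of size at most ν.

open import Defs
open import Data.Nat using (ℕ; _≤_; _*_; _⊔_)

open import Data.Bool using (Bool; true; false; T; T?; not; _∧_; _∨_)
open import Data.Bool.Properties using (T-∧; T-≡; T-not-≡)
open import Data.Fin as Fin using (Fin; toℕ)
import Data.Fin.Properties as Fin
open import Data.List using (List; []; _∷_; _++_; length; filterᵇ; concatMap; map; allFin)
open import Data.List.Properties using (filter-none)
open import Data.List.Membership.Propositional using (_∈_)
open import Data.List.Membership.Propositional.Properties using (∈-∃++; ∈-allFin)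
open import Data.List.Relation.Binary.Disjoint.Propositional using (Disjoint)
open import Data.List.Relation.Binary.Equality.Propositional using (≋⇒≡)
open import Data.List.Relation.Binary.Permutation.Propositional
  using (_↭_; ↭-prep; ↭-trans; ↭-sym; ↭⇒↭ₛ)
open import Data.List.Relation.Binary.Permutation.Propositional.Properties
  using (shift; ∈-resp-↭; ↭-length; map⁺)
open import Data.List.Relation.Binary.Sublist.Propositional using (⊆-refl)
open import Data.List.Relation.Binary.Sublist.Propositional.Properties using (filter⁺; length-mono-≤)
open import Data.List.Relation.Unary.All as All using (All; []; _∷_; reduce)
import Data.List.Relation.Unary.All.Properties as All
open import Data.List.Relation.Unary.AllPairs as AllPairs using (AllPairs; []; _∷_)
import Data.List.Relation.Unary.AllPairs.Properties as AllPairs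
open import Data.List.Relation.Unary.Any using (here; there)
open import Data.List.Relation.Unary.Linked using ([-]; _∷_)
open import Data.List.Relation.Unary.Sorted.TotalOrder using (Sorted)
open import Data.List.Relation.Unary.Sorted.TotalOrder.Properties using (↗↭↗⇒≋)
open import Data.List.Relation.Unary.Unique.Propositional using (Unique)
import Data.List.Relation.Unary.Unique.Propositional.Properties as Unique
open import Data.Nat using (zero; suc; _+_; _<_; _<ᵇ_; _≡ᵇ_; z≤n; s≤s; NonZero; >-nonZero)
open import Data.Nat.Properties
open import Data.Nat.DivMod using (_%_; %-distribˡ-+; [m+kn]%n≡m%n; m%n<n; m<n⇒m%n≡m)
open import Data.Nat.ListAction using (sum)
open import Data.Nat.ListAction.Properties using (sum-↭)
open import Data.Product using (∃-syntax; _×_; _,_; proj₁; proj₂)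
open import Data.Sum using (inj₁; inj₂)
open import Function using (Equivalence; _∘_)
open import Relation.Binary using (tri<; tri≈; tri>)
open import Relation.Binary.PropositionalEquality as ≡
  using (_≡_; _≢_; refl; trans; cong; subst; module ≡-Reasoning)
open import Relation.Nullary using (¬_; contradiction)

private
  split : ∀ {x y} → T (x ∧ y) → T x × T y
  split = Equivalence.to T-∧

  pair : ∀ {x y} → T x → T y → T (x ∧ y)
  pair tx ty = Equivalence.from T-∧ (tx , ty)

  T⇒≡ : ∀ {x} → T x → x ≡ true
  T⇒≡ = Equivalence.to T-≡

  ∧-monoˡ : ∀ {x x′ y} → (T x → T x′) → T (x ∧ y) → T (x′ ∧ y)
  ∧-monoˡ {x} {y = y} f h with tx , ty ← split {x} {y} h = pair (f tx) ty

module _ {A : Set} where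

  length-filterᵇ-mono : {p q : A → Bool} → (∀ x → T (p x) → T (q x)) →
    ∀ xs → length (filterᵇ p xs) ≤ length (filterᵇ q xs)
  length-filterᵇ-mono {p} {q} p⇒q xs =
    length-mono-≤ (filter⁺ (T? ∘ p) (T? ∘ q) (λ { refl → p⇒q _ }) (⊆-refl {x = xs}))

  length-filterᵇ-split : (p q : A → Bool) → ∀ xs →
    length (filterᵇ p xs)
      ≡ length (filterᵇ (λ x → p x ∧ q x) xs) + length (filterᵇ (λ x → p x ∧ not (q x)) xs)
  length-filterᵇ-split p q [] = refl
  length-filterᵇ-split p q (x ∷ xs) with p x | q x
  ... | true  | true  = cong suc (length-filterᵇ-split p q xs)
  ... | true  | false = trans (cong suc (length-filterᵇ-split p q xs)) (≡.sym (+-suc _ _))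
  ... | false | _     = length-filterᵇ-split p q xs

  length-filterᵇ-< : {p q : A → Bool} → (∀ x → T (p x) → T (q x)) →
    ∀ {x xs} → x ∈ xs → ¬ T (p x) → T (q x) → length (filterᵇ p xs) < length (filterᵇ q xs)
  length-filterᵇ-< {p} {q} p⇒q {x} {_ ∷ xs} (here refl) ¬px qx with p x | q x
  ... | true  | _    = contradiction _ ¬px
  ... | false | true = s≤s (length-filterᵇ-mono p⇒q xs)
  length-filterᵇ-< {p} {q} p⇒q {xs = y ∷ xs} (there x∈xs) ¬px qx with p y in py | q y in qy
  ... | true  | true  = s≤s (length-filterᵇ-< p⇒q x∈xs ¬px qx)
  ... | true  | false = contradiction (subst T qy (p⇒q y (subst T (≡.sym py) _))) λ ()
  ... | false | true  = m<n⇒m<1+n (length-filterᵇ-< p⇒q x∈xs ¬px qx)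
  ... | false | false = length-filterᵇ-< p⇒q x∈xs ¬px qx

  colourClass : (A → Bool) → (A → ℕ) → ℕ → A → Bool
  colourClass p colour c x = p x ∧ (colour x ≡ᵇ c)

  length-filterᵇ-≤-colours*classSize :
    (p : A → Bool) (colour : A → ℕ) (m ν : ℕ) (xs : List A) →
    (∀ x → T (p x) → colour x < m) →
    (∀ c → length (filterᵇ (colourClass p colour c) xs) ≤ ν) →
    length (filterᵇ p xs) ≤ m * ν
  length-filterᵇ-≤-colours*classSize p colour zero ν xs colour< _ =
    ≤-reflexive (cong length (filter-none (T? ∘ p) (All.universal (λ x px → n≮0 (colour< x px)) xs)))
  length-filterᵇ-≤-colours*classSize p colour (suc m) ν xs colour< classSize = begin
    length (filterᵇ p xs)
      ≡⟨ length-filterᵇ-split p (λ x → colour x ≡ᵇ m) xs ⟩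
    length (filterᵇ (colourClass p colour m) xs) + length (filterᵇ p′ xs)
      ≤⟨ +-mono-≤ (classSize m)
                  (length-filterᵇ-≤-colours*classSize p′ colour m ν xs colour<′ classSize′) ⟩
    ν + m * ν ∎
    where
    open ≤-Reasoning
    p′ : A → Bool
    p′ x = p x ∧ not (colour x ≡ᵇ m)
    colour<′ : ∀ x → T (p′ x) → colour x < m
    colour<′ x p′x with px , ≢m ← split p′x =
      ≤∧≢⇒< (≤-pred (colour< x px))
            (λ ≡m → subst T (Equivalence.to T-not-≡ ≢m) (≡⇒≡ᵇ _ _ ≡m))
    classSize′ : ∀ c → length (filterᵇ (colourClass p′ colour c) xs) ≤ ν
    classSize′ c =
      ≤-trans (length-filterᵇ-mono (λ x → ∧-monoˡ {p′ x} (proj₁ ∘ split {p x})) xs) (classSize c)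

module _ {A B : Set} {P : A → Set} (f : ∀ {x} → P x → B) where

  length-reduce : ∀ {xs} (pxs : All P xs) → length (reduce f pxs) ≡ length xs
  length-reduce []         = refl
  length-reduce (px ∷ pxs) = cong suc (length-reduce pxs)

  All-reduce : {Q : A → Set} {Q′ : B → Set} → (∀ {x} (px : P x) → Q x → Q′ (f px)) →
    ∀ {xs} (pxs : All P xs) → All Q xs → All Q′ (reduce f pxs)
  All-reduce f-resp []         []         = []
  All-reduce f-resp (px ∷ pxs) (qx ∷ qxs) = f-resp px qx ∷ All-reduce f-resp pxs qxs

  AllPairs-reduce : {R : A → A → Set} {R′ : B → B → Set} →
    (∀ {x y} (px : P x) (py : P y) → R x y → R′ (f px) (f py)) →
    ∀ {xs} (pxs : All P xs) → AllPairs R xs → AllPairs R′ (reduce f pxs)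
  AllPairs-reduce f-resp []         []           = []
  AllPairs-reduce f-resp (px ∷ pxs) (Rx ∷ Rxs) =
    All-reduce (f-resp px) pxs Rx ∷ AllPairs-reduce f-resp pxs Rxs

module _ {A B : Set} where

  Unique-concatMap⁺ : (f : A → List B) (key : B → A) →
    (∀ x → All (λ y → key y ≡ x) (f x)) → (∀ x → Unique (f x)) →
    ∀ {xs} → Unique xs → Unique (concatMap f xs)
  Unique-concatMap⁺ f key keyed f! {xs} xs! =
    Unique.concat⁺ (All.map⁺ (All.universal f! xs)) (AllPairs.map⁺ (AllPairs.map disjoint xs!))
    where
    disjoint : ∀ {x y} → x ≢ y → Disjoint (f x) (f y)
    disjoint x≢y (v∈fx , v∈fy) =
      x≢y (trans (≡.sym (All.lookup (keyed _) v∈fx)) (All.lookup (keyed _) v∈fy))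

triples-unique : ∀ n → Unique (triples n)
triples-unique n =
  Unique-concatMap⁺ _ proj₁ first≡
    (λ _ → Unique-concatMap⁺ _ (proj₁ ∘ proj₂) (λ _ → tabulated-key (λ _ → refl))
             (λ _ → Unique.map⁺ (cong (proj₂ ∘ proj₂)) (Unique.allFin⁺ n)) (Unique.allFin⁺ n))
    (Unique.allFin⁺ n)
  where
  tabulated-key : ∀ {B : Set} {key : Fin n × Fin n × Fin n → B}
                    {g : Fin n → Fin n × Fin n × Fin n} {k} →
    (∀ z → key (g z) ≡ k) → All (λ t → key t ≡ k) (map g (allFin n))
  tabulated-key key∘g≡k = All.map⁺ (All.universal key∘g≡k (allFin n))
  first≡ : ∀ x → All (λ t → proj₁ t ≡ x)
                     (concatMap (λ y → map (λ z → (x , y , z)) (allFin n)) (allFin n))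
  first≡ x = All.concat⁺ (All.map⁺ (All.universal (λ _ → tabulated-key (λ _ → refl)) (allFin n)))

module _ {A : Set} where

  ∈⇒↭∷ : ∀ {x : A} {xs} → x ∈ xs → ∃[ ys ] xs ↭ x ∷ ys
  ∈⇒↭∷ {x} x∈xs with ys , zs , refl ← ∈-∃++ x∈xs = ys ++ zs , shift x ys zs

  ↭-third : ∀ {u v : A} {xs} → length xs ≡ 3 → u ≢ v → u ∈ xs → v ∈ xs →
    ∃[ w ] xs ↭ w ∷ u ∷ v ∷ []
  ↭-third {u} {v} {xs} |xs|≡3 u≢v u∈xs v∈xs
    with ys , xs↭u∷ys ← ∈⇒↭∷ u∈xs
    with ∈-resp-↭ xs↭u∷ys v∈xs
  ... | here v≡u    = contradiction (≡.sym v≡u) u≢v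
  ... | there v∈ys
    with zs , ys↭v∷zs ← ∈⇒↭∷ v∈ys = last zs (↭-trans xs↭u∷ys (↭-prep u ys↭v∷zs))
    where
    last : ∀ zs → xs ↭ u ∷ v ∷ zs → ∃[ w ] xs ↭ w ∷ u ∷ v ∷ []
    last (w ∷ [])    p = w , ↭-trans p (shift w (u ∷ v ∷ []) [])
    last []          p = contradiction (trans (≡.sym |xs|≡3) (↭-length p)) λ ()
    last (_ ∷ _ ∷ _) p = contradiction (trans (≡.sym |xs|≡3) (↭-length p)) λ ()

sum-map-↭ : ∀ {A : Set} (f : A → ℕ) {xs ys} → xs ↭ ys → sum (map f xs) ≡ sum (map f ys)
sum-map-↭ f p = sum-↭ (map⁺ f p)

↗↭↗⇒≡ : ∀ {n} {xs ys : List (Fin n)} →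
  Sorted (Fin.≤-totalOrder n) xs → Sorted (Fin.≤-totalOrder n) ys → xs ↭ ys → xs ≡ ys
↗↭↗⇒≡ {n} xs↗ ys↗ xs↭ys = ≋⇒≡ (↗↭↗⇒≋ (Fin.≤-totalOrder n) xs↗ ys↗ (↭⇒↭ₛ xs↭ys))

%-cancelʳ-+ : ∀ x y k m .{{_ : NonZero m}} → (x + k) % m ≡ (y + k) % m → x % m ≡ y % m
%-cancelʳ-+ x y k m@(suc m′) eq = begin
  x % m                            ≡⟨ +k+m′k-invisible x ⟨
  (x + k + m′ * k) % m             ≡⟨ %-distribˡ-+ (x + k) (m′ * k) m ⟩
  ((x + k) % m + m′ * k % m) % m   ≡⟨ cong (λ r → (r + m′ * k % m) % m) eq ⟩
  ((y + k) % m + m′ * k % m) % m   ≡⟨ %-distribˡ-+ (y + k) (m′ * k) m ⟨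
  (y + k + m′ * k) % m             ≡⟨ +k+m′k-invisible y ⟩
  y % m                            ∎
  where
  open ≡-Reasoning
  -- k + m′ * k is m * k by the definition of _*_.
  +k+m′k-invisible : ∀ z → (z + k + m′ * k) % m ≡ z % m
  +k+m′k-invisible z = trans (cong (_% m) (trans (+-assoc z k (m′ * k)) (cong (z +_) (*-comm m k))))
                             ([m+kn]%n≡m%n z k m)

module _ {n : ℕ} (p : Fin n → Bool) where

  rank : Fin n → ℕ
  rank v = length (filterᵇ (λ u → p u ∧ (toℕ u <ᵇ toℕ v)) (allFin n))

  private
    not-below-self : ∀ v → ¬ T (p v ∧ (toℕ v <ᵇ toℕ v))
    not-below-self v h = n≮n (toℕ v) (<ᵇ⇒< _ _ (proj₂ (split {p v} h)))

  rank<count : ∀ {v} → T (p v) → rank v < length (filterᵇ p (allFin n))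
  rank<count {v} pv =
    length-filterᵇ-< (λ u → proj₁ ∘ split {p u}) (∈-allFin v) (not-below-self v) pv

  rank-strictMono : ∀ {v w} → T (p v) → toℕ v < toℕ w → rank v < rank w
  rank-strictMono {v} {w} pv v<w =
    length-filterᵇ-< below-v⇒below-w (∈-allFin v) (not-below-self v) (pair pv (<⇒<ᵇ v<w))
    where
    below-v⇒below-w : ∀ u → T (p u ∧ (toℕ u <ᵇ toℕ v)) → T (p u ∧ (toℕ u <ᵇ toℕ w))
    below-v⇒below-w u h with pu , u<v ← split {p u} h =
      pair pu (<⇒<ᵇ (<-trans (<ᵇ⇒< _ _ u<v) v<w))

  rank-injective : ∀ {v w} → T (p v) → T (p w) → rank v ≡ rank w → v ≡ w
  rank-injective {v} {w} pv pw eq with Fin.<-cmp v w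
  ... | tri< v<w _ _ = contradiction eq (<⇒≢ (rank-strictMono pv v<w))
  ... | tri≈ _ v≡w _ = v≡w
  ... | tri> _ _ w<v = contradiction (≡.sym eq) (<⇒≢ (rank-strictMono pw w<v))

∈▵⇒∈ : ∀ {n} {G : Graph n} {u : Fin n} {t : Triangle G} →
  u ∈▵ t → u ∈ a t ∷ b t ∷ c t ∷ []
∈▵⇒∈ (inj₁ u≡a)        = here u≡a
∈▵⇒∈ (inj₂ (inj₁ u≡b)) = there (here u≡b)
∈▵⇒∈ (inj₂ (inj₂ u≡c)) = there (there (here u≡c))

indicator : Bool → ℕ
indicator true  = 1
indicator false = 0

indicator-injective : ∀ {x y} → indicator x ≡ indicator y → x ≡ y
indicator-injective {true}  {true}  _ = refl
indicator-injective {false} {false} _ = refl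

two-of-three : ∀ x y z → T (not x ∨ not y ∨ not z) → T (x ∨ y) → T (x ∨ z) → T (y ∨ z) →
  sum (map indicator (x ∷ y ∷ z ∷ [])) ≡ 2
two-of-three true  true  true  ()
two-of-three true  true  false _ _ _ _  = refl
two-of-three true  false true  _ _ _ _  = refl
two-of-three false true  true  _ _ _ _  = refl
two-of-three true  false false _ _ _ ()
two-of-three false true  false _ _ ()
two-of-three false false _     _ ()

module _ {n : ℕ} (G : SplitGraph n) where

  adjacent⇒inK-∨ : ∀ {u v} → adj (graph G) u v ≡ true → T (inK G u ∨ inK G v)
  adjacent⇒inK-∨ {u} {v} uv with inK G u in u∈K | inK G v in v∈K
  ... | true  | _     = _
  ... | false | true  = _
  ... | false | false = contradiction (trans (≡.sym uv) (S-indep G u v u∈K v∈K)) λ ()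

  inKCount : List (Fin n) → ℕ
  inKCount vs = sum (map (indicator ∘ inK G) vs)

  sideRank : Bool → Fin n → ℕ
  sideRank true  = rank (inK G)
  sideRank false = rank (λ v → not (inK G v))

  label : Fin n → ℕ
  label v = sideRank (inK G v) v

  label<max : ∀ v → label v < sizeS G ⊔ sizeK G
  label<max v with inK G v in v∈K
  ... | true  = <-≤-trans (rank<count (inK G) (Equivalence.from T-≡ v∈K))
                          (m≤n⊔m (sizeS G) (sizeK G))
  ... | false = <-≤-trans (rank<count (λ u → not (inK G u)) (Equivalence.from T-not-≡ v∈K))
                          (m≤m⊔n (sizeS G) (sizeK G))

  label-injective : ∀ {v w} → inK G v ≡ inK G w → label v ≡ label w → v ≡ w
  label-injective {v} {w} same-side eq with inK G v in v∈K | inK G w in w∈K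
  ... | true  | true  = rank-injective (inK G)
                          (Equivalence.from T-≡ v∈K) (Equivalence.from T-≡ w∈K) eq
  ... | false | false = rank-injective (λ u → not (inK G u))
                          (Equivalence.from T-not-≡ v∈K) (Equivalence.from T-not-≡ w∈K) eq

  record Mixed (a b c : Fin n) : Set where
    field
      ordered-ab : T (toℕ a <ᵇ toℕ b)
      ordered-bc : T (toℕ b <ᵇ toℕ c)
      adj-ab  : T (adj (graph G) a b)
      adj-ac  : T (adj (graph G) a c)
      adj-bc  : T (adj (graph G) b c)
      some-in-S : T (not (inK G a) ∨ not (inK G b) ∨ not (inK G c))

  isT'⇒Mixed : ∀ {a b c} → T (isT' G (a , b , c)) → Mixed a b c
  isT'⇒Mixed {a} {b} {c} h
    with ordered-ab , h ← split {toℕ a <ᵇ toℕ b} h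
    with ordered-bc , h ← split {toℕ b <ᵇ toℕ c} h
    with adj-ab  , h ← split {adj (graph G) a b} h
    with adj-ac  , h ← split {adj (graph G) a c} h
    with adj-bc  , h ← split {adj (graph G) b c} h
    with _   , some-in-S ← split {inK G a ∨ inK G b ∨ inK G c} h
    = record { ordered-ab = ordered-ab ; ordered-bc = ordered-bc
             ; adj-ab = adj-ab ; adj-ac = adj-ac ; adj-bc = adj-bc
             ; some-in-S = some-in-S }

  module _ {a b c : Fin n} (abc : Mixed a b c) where
    open Mixed abc

    Mixed⇒Triangle : Triangle (graph G)
    Mixed⇒Triangle =
      tri a b c (T⇒≡ ordered-ab) (T⇒≡ ordered-bc) (T⇒≡ adj-ab) (T⇒≡ adj-ac) (T⇒≡ adj-bc)

    Mixed⇒sorted : Sorted (Fin.≤-totalOrder n) (a ∷ b ∷ c ∷ [])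
    Mixed⇒sorted =
      <⇒≤ (<ᵇ⇒< (toℕ a) (toℕ b) ordered-ab) ∷ <⇒≤ (<ᵇ⇒< (toℕ b) (toℕ c) ordered-bc) ∷ [-]

    Mixed⇒inKCount≡2 : inKCount (a ∷ b ∷ c ∷ []) ≡ 2
    Mixed⇒inKCount≡2 = two-of-three (inK G a) (inK G b) (inK G c) some-in-S
      (adjacent⇒inK-∨ (T⇒≡ adj-ab)) (adjacent⇒inK-∨ (T⇒≡ adj-ac))
      (adjacent⇒inK-∨ (T⇒≡ adj-bc))

module _ {n : ℕ} (G : SplitGraph n) .{{_ : NonZero (sizeS G ⊔ sizeK G)}} where

  private
    m : ℕ
    m = sizeS G ⊔ sizeK G

  colour : Fin n × Fin n × Fin n → ℕ
  colour (a , b , c) = sum (map (label G) (a ∷ b ∷ c ∷ [])) % m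

  third-vertex-unique : ∀ {a b c a′ b′ c′ u v w w′} → Mixed G a b c → Mixed G a′ b′ c′ →
    colour (a , b , c) ≡ colour (a′ , b′ , c′) →
    a ∷ b ∷ c ∷ [] ↭ w ∷ u ∷ v ∷ [] → a′ ∷ b′ ∷ c′ ∷ [] ↭ w′ ∷ u ∷ v ∷ [] →
    w ≡ w′
  third-vertex-unique {a} {b} {c} {a′} {b′} {c′} {u} {v} {w} {w′}
                      abc abc′ same-colour t↭wuv t′↭w′uv =
    label-injective G same-side same-label
    where
    open ≡-Reasoning
    same-side : inK G w ≡ inK G w′
    same-side = indicator-injective (+-cancelʳ-≡ _ _ _ (begin
      inKCount G (w ∷ u ∷ v ∷ [])      ≡⟨ sum-map-↭ (indicator ∘ inK G) t↭wuv ⟨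
      inKCount G (a ∷ b ∷ c ∷ [])      ≡⟨ Mixed⇒inKCount≡2 G abc ⟩
      2                                ≡⟨ Mixed⇒inKCount≡2 G abc′ ⟨
      inKCount G (a′ ∷ b′ ∷ c′ ∷ [])   ≡⟨ sum-map-↭ (indicator ∘ inK G) t′↭w′uv ⟩
      inKCount G (w′ ∷ u ∷ v ∷ [])     ∎))
    same-label-mod :
      sum (map (label G) (w ∷ u ∷ v ∷ [])) % m ≡ sum (map (label G) (w′ ∷ u ∷ v ∷ [])) % m
    same-label-mod = begin
      sum (map (label G) (w ∷ u ∷ v ∷ [])) % m    ≡⟨ cong (_% m) (sum-map-↭ (label G) t↭wuv) ⟨
      colour (a , b , c)                          ≡⟨ same-colour ⟩
      colour (a′ , b′ , c′)                       ≡⟨ cong (_% m) (sum-map-↭ (label G) t′↭w′uv) ⟩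
      sum (map (label G) (w′ ∷ u ∷ v ∷ [])) % m   ∎
    same-label : label G w ≡ label G w′
    same-label = begin
      label G w        ≡⟨ m<n⇒m%n≡m (label<max G w) ⟨
      label G w % m    ≡⟨ %-cancelʳ-+ (label G w) (label G w′) _ m same-label-mod ⟩
      label G w′ % m   ≡⟨ m<n⇒m%n≡m (label<max G w′) ⟩
      label G w′       ∎

  shared-edge⇒≡ : ∀ {a b c a′ b′ c′ u v} → Mixed G a b c → Mixed G a′ b′ c′ →
    colour (a , b , c) ≡ colour (a′ , b′ , c′) → u ≢ v →
    u ∈ a ∷ b ∷ c ∷ [] → v ∈ a ∷ b ∷ c ∷ [] → u ∈ a′ ∷ b′ ∷ c′ ∷ [] → v ∈ a′ ∷ b′ ∷ c′ ∷ [] →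
    (a , b , c) ≡ (a′ , b′ , c′)
  shared-edge⇒≡ abc abc′ same-colour u≢v u∈t v∈t u∈t′ v∈t′
    with w  , t↭wuv   ← ↭-third refl u≢v u∈t  v∈t
    with w′ , t′↭w′uv ← ↭-third refl u≢v u∈t′ v∈t′
    with refl ← third-vertex-unique abc abc′ same-colour t↭wuv t′↭w′uv
    with refl ← ↗↭↗⇒≡ (Mixed⇒sorted G abc) (Mixed⇒sorted G abc′)
                      (↭-trans t↭wuv (↭-sym t′↭w′uv))
    = refl

  colourClass-size≤ν : ∀ {ν} → IsNu (graph G) ν → ∀ c →
    length (filterᵇ (colourClass (isT' G) colour c) (triples n)) ≤ ν
  colourClass-size≤ν {ν} (_ , maximum) c = begin
    length (filterᵇ inClass (triples n))  ≡⟨ length-reduce triangle members ⟨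
    length (reduce triangle members)
      ≤⟨ maximum _ (AllPairs-reduce triangle edge-disjoint members distinct) ⟩
    ν                                     ∎
    where
    open ≤-Reasoning
    inClass = colourClass (isT' G) colour c
    members : All (T ∘ inClass) (filterᵇ inClass (triples n))
    members = All.all-filter (T? ∘ inClass) (triples n)
    distinct : Unique (filterᵇ inClass (triples n))
    distinct = AllPairs.filter⁺ (T? ∘ inClass) (triples-unique n)
    mixed : ∀ {t} → T (inClass t) → Mixed G (proj₁ t) (proj₁ (proj₂ t)) (proj₂ (proj₂ t))
    mixed {t} h = isT'⇒Mixed G (proj₁ (split {isT' G t} h))
    colour≡c : ∀ {t} → T (inClass t) → colour t ≡ c
    colour≡c {t} h = ≡ᵇ⇒≡ _ _ (proj₂ (split {isT' G t} h))
    triangle : ∀ {t} → T (inClass t) → Triangle (graph G)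
    triangle h = Mixed⇒Triangle G (mixed h)
    edge-disjoint : ∀ {t t′} (h : T (inClass t)) (h′ : T (inClass t′)) → t ≢ t′ →
      EdgeDisjoint (triangle h) (triangle h′)
    edge-disjoint h h′ t≢t′ u v u≢v u∈t v∈t u∈t′ v∈t′ =
      t≢t′ (shared-edge⇒≡ (mixed h) (mixed h′)
              (trans (colour≡c h) (≡.sym (colour≡c h′))) u≢v
              (∈▵⇒∈ {t = triangle h} u∈t) (∈▵⇒∈ {t = triangle h} v∈t)
              (∈▵⇒∈ {t = triangle h′} u∈t′) (∈▵⇒∈ {t = triangle h′} v∈t′))

corollary2 : ∀ (n : ℕ) (G : SplitGraph n) (ν : ℕ) → IsNu (graph G) ν →
    sizeT' G ≤ ν * (sizeS G ⊔ sizeK G)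
corollary2 zero    G ν _    = z≤n
corollary2 (suc n) G ν isNu = begin
  sizeT' G  ≤⟨ length-filterᵇ-≤-colours*classSize (isT' G) (colour G) m ν (triples (suc n))
                 (λ t _ → m%n<n _ m) (colourClass-size≤ν G isNu) ⟩
  m * ν     ≡⟨ *-comm m ν ⟩
  ν * m     ∎
  where
  open ≤-Reasoning
  m = sizeS G ⊔ sizeK G
  instance
    m-nonZero : NonZero m
    m-nonZero = >-nonZero (m<n⇒0<n (label<max G Fin.zero))
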